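{- Let $A$ be an abelian group (written multiplicatively), let $d\ge k\ge1$ be integers, and let $B$ be the group of all functions $h:(d)\to A$ under pointwise multiplication, where $(d)$ is the power set of $[d]=\{1,\dots,d\}$. Let $B_{d,k}$ be the subgroup of those $h$ with $\prod_{S\in\Lambda}h(S)=1$ for every $(d-k+1)$-dimensional face $\Lambda$. Then $B_{d,k}$ is generated by the elements $g(\Lambda,a)$, where $\Lambda$ is a $k$-dimensional face and $a\in A$, defined by $g(\Lambda,a)(S)=1$ for $S\notin\Lambda$ and $g(\Lambda,a)(S)=a^{(-1)^{|S|}}$ for $S\in\Lambda$.
   Context: An $n$-dimensional face of $(d)$ is a set of subsets of $[d]$ of the form $\{S\cup K: S\subseteq F\}$, where $K,F\subseteq[d]$ are disjoint and $|F|=n$. -}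

module Defs where

open import Level using (Level; _⊔_)
open import Algebra.Bundles using (AbelianGroup)
open import Data.Nat using (ℕ; zero; suc)
open import Data.Bool using (Bool; true; false; if_then_else_)
import Data.Bool as Bool
open import Data.List using (List; []; _∷_; map; foldr; filter; _++_)
open import Data.Bool.ListAction using (any)
open import Data.Vec using (Vec; []; _∷_)
open import Data.Vec.Properties using (≡-dec)
open import Data.Fin using (Fin)
open import Data.Fin.Subset using (Subset; _∪_; _⊆_; _∈_; _∉_; ∣_∣; inside; outside)
open import Data.Fin.Subset.Properties using (_⊆?_)
open import Relation.Nullary using (does)
open import Relation.Binary.PropositionalEquality using (_≡_)

allSubsets : (n : ℕ) → List (Subset n)
allSubsets zero = [] ∷ []
allSubsets (suc n) = map (outside ∷_) (allSubsets n) ++ map (inside ∷_) (allSubsets n)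

subsetsOf : ∀ {d} → Subset d → List (Subset d)
subsetsOf {d} F = filter (_⊆? F) (allSubsets d)

_≟S_ : ∀ {d} → (S T : Subset d) → Relation.Nullary.Dec (S ≡ T)
_≟S_ = ≡-dec Bool._≟_

-- an n-dimensional face of (d): data K, F disjoint with |F| = n;
-- it is the set { S ∪ K : S ⊆ F }
record Face (d n : ℕ) : Set where
  constructor face
  field
    K F      : Subset d
    disjoint : ∀ i → i ∈ K → i ∉ F
    dim      : ∣ F ∣ ≡ n
open Face public

-- the list of elements of the face (no repetitions, since K and F are disjoint)
elems : ∀ {d n} → Face d n → List (Subset d)
elems Λ = map (λ T → T ∪ K Λ) (subsetsOf (F Λ))

inFace : ∀ {d n} → Subset d → Face d n → Bool
inFace S Λ = any (λ T → does (S ≟S (T ∪ K Λ))) (subsetsOf (F Λ))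

even : ℕ → Bool
even zero = true
even (suc n) = Bool.not (even n)

module Cube {c ℓ : Level} (A : AbelianGroup c ℓ) (d : ℕ) where
  open AbelianGroup A

  B : Set c
  B = Subset d → Carrier

  one : B
  one _ = ε

  _·_ : B → B → B
  (h · h') S = h S ∙ h' S

  inv : B → B
  inv h S = h S ⁻¹

  faceProd : ∀ {n} → B → Face d n → Carrier
  faceProd h Λ = foldr (λ S x → h S ∙ x) ε (elems Λ)

  InBdk : ℕ → B → Set ℓ
  InBdk k h = ∀ (Λ : Face d (suc (d Data.Nat.∸ k))) → faceProd h Λ ≈ ε

  g : ∀ {n} → Face d n → Carrier → B
  g Λ a S = if inFace S Λ then (if even ∣ S ∣ then a else a ⁻¹) else ε

  data Generated (k : ℕ) : B → Set (c ⊔ ℓ) where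
    gen  : (Λ : Face d k) (a : Carrier) → Generated k (g Λ a)
    gone : Generated k one
    gmul : ∀ {h h'} → Generated k h → Generated k h' → Generated k (h · h')
    ginv : ∀ {h} → Generated k h → Generated k (inv h)
    gext : ∀ {h h'} → Generated k h → (∀ S → h S ≈ h' S) → Generated k h'

-- For faces Λ, Λ′ of dimensions k and m with k + m > d, go through the coordinates. Where
-- Λ′ is fixed, restricting to it leaves either 1 or a generator g(Λ₀, a^{±1}) of a face Λ₀ one
-- dimension lower, so induction applies; at a coordinate free in both faces, g(Λ, a) takes
-- mutually inverse values on the two halves of Λ′, whose products therefore cancel.
--
-- Conversely, let h on (d+1) have trivial products over all m-faces, where k + m = d + 2.
-- Its restriction h₀ to the sets avoiding the first coordinate has trivial products over
-- the m-faces of (d), so by induction it is generated by (k−1)-faces, and gluing h₀ with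
-- h₀⁻¹ gives an element generated by the k-dimensional cylinders Λ × {0, 1}. Dividing h by
-- it leaves an element supported on the sets containing the first coordinate, trivial over
-- the (m−1)-faces there, so a second induction finishes. When k = 0 every h is a product
-- of vertex generators; when m = 0 the hypothesis says h = 1.

module Submission where

open import Defs
open import Level using (Level)
open import Algebra.Bundles using (AbelianGroup)
open import Data.Bool using (Bool; true; false; _∧_; _∨_; if_then_else_)
import Data.Bool as Bool
open import Data.Bool.ListAction using (any; or)
open import Data.Bool.Properties using (∨-identityʳ; ∨-assoc; ∧-distribʳ-∨; ∧-distribˡ-∨; ∧-zeroʳ)
open import Data.Empty using (⊥-elim)
open import Data.Fin using () renaming (zero to fzero; suc to fsuc)
open import Data.Fin.Subset using (Subset; _∪_; _∈_; _∉_; ∣_∣; inside; outside; ⊥)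
open import Data.Fin.Subset.Properties using (_⊆?_; ∉⊥; ∣⊥∣≡0)
open import Data.List using (List; []; _∷_; map; foldr; filter; _++_)
open import Data.List.Properties using (++-identityʳ; map-∘; filter-++; filter-none; foldr-map)
open import Data.List.Relation.Unary.All using (universal)
open import Data.List.Relation.Unary.All.Properties using (map⁺)
open import Data.Nat using (ℕ; zero; suc; _+_; _<_; _≤_; _∸_)
open import Data.Nat.Properties using (<-trans; n<1+n; <-pred; +-suc; suc-injective; ≤-reflexive; m+[n∸m]≡n)
open import Data.Product using (_×_; _,_)
open import Data.Vec using ([]; _∷_; here; there)
open import Function using (_∘_; case_of_)
open import Relation.Nullary using (does)
open import Relation.Unary using (Pred; Decidable)
open import Relation.Binary.PropositionalEquality as ≡ using (_≡_; cong; cong₂; subst; module ≡-Reasoning)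

filter-map : ∀ {a b p q} {A : Set a} {B : Set b} {P : Pred B p} {Q : Pred A q}
  (P? : Decidable P) (Q? : Decidable Q) (f : A → B) →
  (∀ x → does (P? (f x)) ≡ does (Q? x)) →
  ∀ xs → filter P? (map f xs) ≡ map f (filter Q? xs)
filter-map P? Q? f same [] = ≡.refl
filter-map P? Q? f same (x ∷ xs) with does (P? (f x)) | does (Q? x) | same x
... | true  | true  | ≡.refl = cong (f x ∷_) (filter-map P? Q? f same xs)
... | false | false | ≡.refl = filter-map P? Q? f same xs

subsetsOf-outside∷ : ∀ {d} (F : Subset d) → subsetsOf (outside ∷ F) ≡ map (outside ∷_) (subsetsOf F)
subsetsOf-outside∷ {d} F = ≡.trans (filter-++ (_⊆? (outside ∷ F)) (map (outside ∷_) L) (map (inside ∷_) L))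
  (≡.trans (cong₂ _++_ (filter-map _ _ _ (λ _ → ≡.refl) L) none) (++-identityʳ _))
  where
  L : List (Subset d)
  L = allSubsets d
  none : filter (_⊆? (outside ∷ F)) (map (inside ∷_) L) ≡ []
  none = filter-none (_⊆? (outside ∷ F)) (map⁺ (universal (λ _ ⊆F → case ⊆F here of λ ()) L))

subsetsOf-inside∷ : ∀ {d} (F : Subset d) →
  subsetsOf (inside ∷ F) ≡ map (outside ∷_) (subsetsOf F) ++ map (inside ∷_) (subsetsOf F)
subsetsOf-inside∷ {d} F = ≡.trans (filter-++ (_⊆? (inside ∷ F)) (map (outside ∷_) L) (map (inside ∷_) L))
  (cong₂ _++_ (filter-map _ _ _ (λ _ → ≡.refl) L) (filter-map _ _ _ (λ _ → ≡.refl) L))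
  where
  L : List (Subset d)
  L = allSubsets d

any-++ : ∀ {a} {A : Set a} (p : A → Bool) xs ys → any p (xs ++ ys) ≡ any p xs ∨ any p ys
any-++ p []       ys = ≡.refl
any-++ p (x ∷ xs) ys = ≡.trans (cong (p x ∨_) (any-++ p xs ys)) (≡.sym (∨-assoc (p x) _ _))

any-map : ∀ {a b} {A : Set a} {B : Set b} (p : B → Bool) (f : A → B) xs → any p (map f xs) ≡ any (p ∘ f) xs
any-map p f xs = cong or (≡.sym (map-∘ xs))

any-∧ : ∀ {a} {A : Set a} (b : Bool) (p : A → Bool) xs → any (λ x → b ∧ p x) xs ≡ b ∧ any p xs
any-∧ b p []       = ≡.sym (∧-zeroʳ b)
any-∧ b p (x ∷ xs) = ≡.trans (cong ((b ∧ p x) ∨_) (any-∧ b p xs)) (≡.sym (∧-distribˡ-∨ b (p x) (any p xs)))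

any-subsetsOf-∷ : ∀ {d} (p : Subset (suc d) → Bool) f (F : Subset d) →
  any p (subsetsOf (f ∷ F)) ≡ any (p ∘ (outside ∷_)) (subsetsOf F) ∨ (f ∧ any (p ∘ (inside ∷_)) (subsetsOf F))
any-subsetsOf-∷ p false F = begin
  any p (subsetsOf (outside ∷ F))                 ≡⟨ cong (any p) (subsetsOf-outside∷ F) ⟩
  any p (map (outside ∷_) (subsetsOf F))          ≡⟨ any-map p _ (subsetsOf F) ⟩
  any (p ∘ (outside ∷_)) (subsetsOf F)            ≡⟨ ∨-identityʳ _ ⟨
  any (p ∘ (outside ∷_)) (subsetsOf F) ∨ false    ∎
  where open ≡-Reasoning
any-subsetsOf-∷ p true F = begin
  any p (subsetsOf (inside ∷ F))
    ≡⟨ cong (any p) (subsetsOf-inside∷ F) ⟩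
  any p (map (outside ∷_) (subsetsOf F) ++ map (inside ∷_) (subsetsOf F))
    ≡⟨ any-++ p (map (outside ∷_) (subsetsOf F)) _ ⟩
  any p (map (outside ∷_) (subsetsOf F)) ∨ any p (map (inside ∷_) (subsetsOf F))
    ≡⟨ cong₂ _∨_ (any-map p _ (subsetsOf F)) (any-map p _ (subsetsOf F)) ⟩
  any (p ∘ (outside ∷_)) (subsetsOf F) ∨ any (p ∘ (inside ∷_)) (subsetsOf F) ∎
  where open ≡-Reasoning

-- The values t ∨ k, t ≤ f, of one coordinate of T ∪ K (T ⊆ F), where k and f are that
-- coordinate of K and F; this is the form in which it falls out of inFace.
allowed : Bool → Bool → Bool → Bool
allowed k false s = does (s Bool.≟ k)
allowed k true  s = does (s Bool.≟ k) ∨ does (s Bool.≟ true)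

memberOf : ∀ {d} → Subset d → Subset d → Subset d → Bool
memberOf []      []      []      = true
memberOf (k ∷ K) (f ∷ F) (s ∷ S) = allowed k f s ∧ memberOf K F S

any-subsetsOf≡memberOf : ∀ {d} (K F S : Subset d) →
  any (λ T → does (S ≟S (T ∪ K))) (subsetsOf F) ≡ memberOf K F S
any-subsetsOf≡memberOf []      []      []      = ≡.refl
any-subsetsOf≡memberOf {suc d} (k ∷ K) (f ∷ F) (s ∷ S) = begin
  any (λ T → does ((s ∷ S) ≟S (T ∪ (k ∷ K)))) (subsetsOf (f ∷ F))
    ≡⟨ any-subsetsOf-∷ _ f F ⟩
  any (λ T → s≟k ∧ p T) (subsetsOf F) ∨ (f ∧ any (λ T → s≟true ∧ p T) (subsetsOf F))
    ≡⟨ cong₂ (λ x y → x ∨ (f ∧ y)) (any-∧ s≟k p (subsetsOf F)) (any-∧ s≟true p (subsetsOf F)) ⟩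
  (s≟k ∧ any p (subsetsOf F)) ∨ (f ∧ (s≟true ∧ any p (subsetsOf F)))
    ≡⟨ cong (λ M → (s≟k ∧ M) ∨ (f ∧ (s≟true ∧ M))) (any-subsetsOf≡memberOf K F S) ⟩
  (s≟k ∧ memberOf K F S) ∨ (f ∧ (s≟true ∧ memberOf K F S))
    ≡⟨ distrib f ⟩
  allowed k f s ∧ memberOf K F S ∎
  where
  open ≡-Reasoning
  s≟k s≟true : Bool
  s≟k    = does (s Bool.≟ k)
  s≟true = does (s Bool.≟ true)
  p : Subset d → Bool
  p T = does (S ≟S (T ∪ K))
  distrib : ∀ f → (s≟k ∧ memberOf K F S) ∨ (f ∧ (s≟true ∧ memberOf K F S)) ≡ allowed k f s ∧ memberOf K F S
  distrib false = ∨-identityʳ _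
  distrib true  = ≡.sym (∧-distribʳ-∨ _ s≟k s≟true)

Disjoint : ∀ {d} → Subset d → Subset d → Set
Disjoint K F = ∀ i → i ∈ K → i ∉ F

Disjoint-tail : ∀ {d k f} {K F : Subset d} → Disjoint (k ∷ K) (f ∷ F) → Disjoint K F
Disjoint-tail disj i i∈K i∈F = disj (fsuc i) (there i∈K) (there i∈F)

<-drop-heads : ∀ {d} f f′ (F F′ : Subset d) → f ∧ f′ ≡ false →
  suc d < ∣ f ∷ F ∣ + ∣ f′ ∷ F′ ∣ → d < ∣ F ∣ + ∣ F′ ∣
<-drop-heads false false F F′ _ lt = <-trans (n<1+n _) lt
<-drop-heads true  false F F′ _ lt = <-pred lt
<-drop-heads {d} false true  F F′ _ lt = <-pred (subst (suc d <_) (+-suc ∣ F ∣ ∣ F′ ∣) lt)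

cylinder : ∀ {d n} → Face d n → Face (suc d) (suc n)
cylinder Λ = face (outside ∷ K Λ) (inside ∷ F Λ) disj (cong suc (dim Λ))
  where
  disj : Disjoint (outside ∷ K Λ) (inside ∷ F Λ)
  disj (fsuc i) (there i∈K) (there i∈F) = disjoint Λ i i∈K i∈F

layer : ∀ {d n} → Bool → Face d n → Face (suc d) n
layer b Λ = face (b ∷ K Λ) (outside ∷ F Λ) disj (dim Λ)
  where
  disj : Disjoint (b ∷ K Λ) (outside ∷ F Λ)
  disj (fsuc i) (there i∈K) (there i∈F) = disjoint Λ i i∈K i∈F

vertex : ∀ {d} → Subset d → Face d 0
vertex {d} S = face S ⊥ (λ _ _ → ∉⊥) (∣⊥∣≡0 d)

module _ {c ℓ : Level} (A : AbelianGroup c ℓ) where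
  open AbelianGroup A
  open import Algebra.Properties.AbelianGroup A using (⁻¹-∙-comm)
  open import Algebra.Properties.Group group using (ε⁻¹≈ε; ⁻¹-involutive)
  open import Algebra.Properties.CommutativeSemigroup commutativeSemigroup using (interchange)
  open import Relation.Binary.Reasoning.Setoid setoid
  open Cube A using (g; faceProd; Generated; gen; gone; gmul; ginv; gext)

  listProd : ∀ {a} {X : Set a} → (X → Carrier) → List X → Carrier
  listProd h = foldr (λ x y → h x ∙ y) ε

  listProd-++ : ∀ {a} {X : Set a} (h : X → Carrier) xs ys → listProd h (xs ++ ys) ≈ listProd h xs ∙ listProd h ys
  listProd-++ h []       ys = sym (identityˡ _)
  listProd-++ h (x ∷ xs) ys = trans (∙-congˡ (listProd-++ h xs ys)) (sym (assoc _ _ _))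

  -- The product over {T ∪ K : T ⊆ F}. Reading the lower half through k (which is outside
  -- on genuine faces) makes listProd-subsetsOf hold for all K and F.
  cubeProd : ∀ {d} → Subset d → Subset d → (Subset d → Carrier) → Carrier
  cubeProd []      []            h = h []
  cubeProd (k ∷ K) (outside ∷ F) h = cubeProd K F (λ S → h (k ∷ S))
  cubeProd (k ∷ K) (inside  ∷ F) h = cubeProd K F (λ S → h (k ∷ S)) ∙ cubeProd K F (λ S → h (inside ∷ S))

  listProd-subsetsOf : ∀ {d} (K F : Subset d) h → listProd (λ T → h (T ∪ K)) (subsetsOf F) ≈ cubeProd K F h
  listProd-subsetsOf []      []            h = identityʳ _
  listProd-subsetsOf {suc d} (k ∷ K) (outside ∷ F) h = begin
    listProd h′ (subsetsOf (outside ∷ F))                ≡⟨ cong (listProd h′) (subsetsOf-outside∷ F) ⟩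
    listProd h′ (map (outside ∷_) (subsetsOf F))         ≡⟨ foldr-map _ _ ε (subsetsOf F) ⟩
    listProd (λ T → h (k ∷ (T ∪ K))) (subsetsOf F)      ≈⟨ listProd-subsetsOf K F _ ⟩
    cubeProd K F (λ S → h (k ∷ S))                       ∎
    where
    h′ : Subset (suc d) → Carrier
    h′ T = h (T ∪ (k ∷ K))
  listProd-subsetsOf {suc d} (k ∷ K) (inside  ∷ F) h = begin
    listProd h′ (subsetsOf (inside ∷ F))
      ≡⟨ cong (listProd h′) (subsetsOf-inside∷ F) ⟩
    listProd h′ (map (outside ∷_) (subsetsOf F) ++ map (inside ∷_) (subsetsOf F))
      ≈⟨ listProd-++ h′ (map (outside ∷_) (subsetsOf F)) _ ⟩
    listProd h′ (map (outside ∷_) (subsetsOf F)) ∙ listProd h′ (map (inside ∷_) (subsetsOf F))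
      ≡⟨ ≡.cong₂ _∙_ (foldr-map _ _ ε (subsetsOf F)) (foldr-map _ _ ε (subsetsOf F)) ⟩
    listProd (λ T → h (k ∷ (T ∪ K))) (subsetsOf F) ∙ listProd (λ T → h (inside ∷ (T ∪ K))) (subsetsOf F)
      ≈⟨ ∙-cong (listProd-subsetsOf K F _) (listProd-subsetsOf K F _) ⟩
    cubeProd (k ∷ K) (inside ∷ F) h ∎
    where
    h′ : Subset (suc d) → Carrier
    h′ T = h (T ∪ (k ∷ K))

  faceProd≈cubeProd : ∀ {d n} (h : Subset d → Carrier) (Λ : Face d n) → faceProd d h Λ ≈ cubeProd (K Λ) (F Λ) h
  faceProd≈cubeProd h Λ = trans (reflexive (foldr-map _ _ ε (subsetsOf (F Λ)))) (listProd-subsetsOf (K Λ) (F Λ) h)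

  cubeProd-cong : ∀ {d} (K F : Subset d) {h h′} → (∀ S → h S ≈ h′ S) → cubeProd K F h ≈ cubeProd K F h′
  cubeProd-cong []      []            h≈h′ = h≈h′ []
  cubeProd-cong (k ∷ K) (outside ∷ F) h≈h′ = cubeProd-cong K F (h≈h′ ∘ (k ∷_))
  cubeProd-cong (k ∷ K) (inside  ∷ F) h≈h′ = ∙-cong (cubeProd-cong K F (h≈h′ ∘ (k ∷_))) (cubeProd-cong K F (h≈h′ ∘ (inside ∷_)))

  cubeProd-ε : ∀ {d} (K F : Subset d) {h} → (∀ S → h S ≈ ε) → cubeProd K F h ≈ ε
  cubeProd-ε []      []            h≈ε = h≈ε []
  cubeProd-ε (k ∷ K) (outside ∷ F) h≈ε = cubeProd-ε K F (h≈ε ∘ (k ∷_))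
  cubeProd-ε (k ∷ K) (inside  ∷ F) h≈ε =
    trans (∙-cong (cubeProd-ε K F (h≈ε ∘ (k ∷_))) (cubeProd-ε K F (h≈ε ∘ (inside ∷_)))) (identityˡ ε)

  cubeProd-∙ : ∀ {d} (K F : Subset d) h h′ → cubeProd K F (λ S → h S ∙ h′ S) ≈ cubeProd K F h ∙ cubeProd K F h′
  cubeProd-∙ []      []            h h′ = refl
  cubeProd-∙ (k ∷ K) (outside ∷ F) h h′ = cubeProd-∙ K F _ _
  cubeProd-∙ (k ∷ K) (inside  ∷ F) h h′ = trans (∙-cong (cubeProd-∙ K F _ _) (cubeProd-∙ K F _ _)) (interchange _ _ _ _)

  cubeProd-⁻¹ : ∀ {d} (K F : Subset d) h → cubeProd K F (λ S → h S ⁻¹) ≈ cubeProd K F h ⁻¹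
  cubeProd-⁻¹ []      []            h = refl
  cubeProd-⁻¹ (k ∷ K) (outside ∷ F) h = cubeProd-⁻¹ K F _
  cubeProd-⁻¹ (k ∷ K) (inside  ∷ F) h = trans (∙-cong (cubeProd-⁻¹ K F _) (cubeProd-⁻¹ K F _)) (⁻¹-∙-comm _ _)

  generator : ∀ {d} → Subset d → Subset d → Carrier → Subset d → Carrier
  generator K F a S = if memberOf K F S then (if even ∣ S ∣ then a else a ⁻¹) else ε

  g≡generator : ∀ {d n} (Λ : Face d n) a S → g d Λ a S ≡ generator (K Λ) (F Λ) a S
  g≡generator Λ a S = cong (λ M → if M then (if even ∣ S ∣ then a else a ⁻¹) else ε) (any-subsetsOf≡memberOf (K Λ) (F Λ) S)

  generator-⁻¹ : ∀ {d} (K F : Subset d) a S → generator K F (a ⁻¹) S ≈ generator K F a S ⁻¹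
  generator-⁻¹ K F a S with memberOf K F S | even ∣ S ∣
  ... | false | _     = sym ε⁻¹≈ε
  ... | true  | true  = refl
  ... | true  | false = refl

  generator-cong : ∀ {d} (K F : Subset d) {a b} → a ≈ b → ∀ S → generator K F a S ≈ generator K F b S
  generator-cong K F a≈b S with memberOf K F S | even ∣ S ∣
  ... | false | _     = refl
  ... | true  | true  = a≈b
  ... | true  | false = ⁻¹-cong a≈b

  generator-slice : ∀ {d} k f b (K F : Subset d) a S → allowed k f b ≡ true →
    generator (k ∷ K) (f ∷ F) a (b ∷ S) ≈ generator K F (if b then a ⁻¹ else a) S
  generator-slice k f outside K F a S allowed≡true rewrite allowed≡true = refl
  generator-slice k f inside  K F a S allowed≡true rewrite allowed≡true with memberOf K F S | even ∣ S ∣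
  ... | false | _     = refl
  ... | true  | true  = refl
  ... | true  | false = sym (⁻¹-involutive a)

  generator-slice-ε : ∀ {d} k f b (K F : Subset d) a S → allowed k f b ≡ false →
    generator (k ∷ K) (f ∷ F) a (b ∷ S) ≈ ε
  generator-slice-ε k f b K F a S allowed≡false rewrite allowed≡false = refl

  cubeProd-slice-generator : ∀ {d} k f b (K F K′ F′ : Subset d) →
    (∀ a → cubeProd K′ F′ (generator K F a) ≈ ε) →
    ∀ a → cubeProd K′ F′ (λ S → generator (k ∷ K) (f ∷ F) a (b ∷ S)) ≈ ε
  cubeProd-slice-generator k f b K F K′ F′ vanishes a = by-allowed (allowed k f b) ≡.refl
    where
    by-allowed : ∀ x → allowed k f b ≡ x → cubeProd K′ F′ (λ S → generator (k ∷ K) (f ∷ F) a (b ∷ S)) ≈ ε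
    by-allowed true  eq = trans (cubeProd-cong K′ F′ (λ S → generator-slice k f b K F a S eq)) (vanishes _)
    by-allowed false eq = cubeProd-ε K′ F′ (λ S → generator-slice-ε k f b K F a S eq)

  generator-orthogonal : ∀ {d} (K F K′ F′ : Subset d) → Disjoint K F → Disjoint K′ F′ →
    d < ∣ F ∣ + ∣ F′ ∣ → ∀ a → cubeProd K′ F′ (generator K F a) ≈ ε
  generator-orthogonal [] [] [] [] _ _ () _
  generator-orthogonal (inside ∷ K) (inside ∷ F) _ _ disj _ _ _ = ⊥-elim (disj fzero here here)
  generator-orthogonal _ _ (inside ∷ K′) (inside ∷ F′) _ disj′ _ _ = ⊥-elim (disj′ fzero here here)
  generator-orthogonal (k ∷ K) (f ∷ F) (k′ ∷ K′) (outside ∷ F′) disj disj′ lt =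
    cubeProd-slice-generator k f k′ K F K′ F′
      (generator-orthogonal K F K′ F′ (Disjoint-tail disj) (Disjoint-tail disj′) (<-drop-heads f outside F F′ (∧-zeroʳ f) lt))
  generator-orthogonal (k ∷ K) (outside ∷ F) (outside ∷ K′) (inside ∷ F′) disj disj′ lt a =
    trans (∙-cong (slice outside) (slice inside)) (identityˡ ε)
    where
    vanishes : ∀ a → cubeProd K′ F′ (generator K F a) ≈ ε
    vanishes = generator-orthogonal K F K′ F′ (Disjoint-tail disj) (Disjoint-tail disj′) (<-drop-heads outside inside F F′ ≡.refl lt)
    slice : ∀ b → cubeProd K′ F′ (λ S → generator (k ∷ K) (outside ∷ F) a (b ∷ S)) ≈ ε
    slice b = cubeProd-slice-generator k outside b K F K′ F′ vanishes a
  -- Both faces are free here: the two halves of Λ′ carry inverse values.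
  generator-orthogonal (outside ∷ K) (inside ∷ F) (outside ∷ K′) (inside ∷ F′) _ _ _ a = begin
    P ∙ cubeProd K′ F′ (λ S → generator (outside ∷ K) (inside ∷ F) a (inside ∷ S))
      ≈⟨ ∙-congˡ (cubeProd-cong K′ F′ λ S → trans (generator-slice outside inside inside K F a S ≡.refl) (generator-⁻¹ K F a S)) ⟩
    P ∙ cubeProd K′ F′ (λ S → generator K F a S ⁻¹)
      ≈⟨ ∙-congˡ (cubeProd-⁻¹ K′ F′ _) ⟩
    P ∙ P ⁻¹
      ≈⟨ inverseʳ P ⟩
    ε ∎
    where
    P : Carrier
    P = cubeProd K′ F′ (generator K F a)

  FaceTrivial : ∀ d → ℕ → (Subset d → Carrier) → Set ℓ
  FaceTrivial d m h = ∀ (Λ : Face d m) → cubeProd (K Λ) (F Λ) h ≈ ε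

  Generated⇒FaceTrivial : ∀ {d k m h} → d < k + m → Generated d k h → FaceTrivial d m h
  Generated⇒FaceTrivial {d} lt (gen Λ a) Λ′ =
    trans (cubeProd-cong (K Λ′) (F Λ′) (reflexive ∘ g≡generator Λ a))
          (generator-orthogonal (K Λ) (F Λ) (K Λ′) (F Λ′) (disjoint Λ) (disjoint Λ′) lt′ a)
    where
    lt′ : d < ∣ F Λ ∣ + ∣ F Λ′ ∣
    lt′ = subst (d <_) (≡.sym (cong₂ _+_ (dim Λ) (dim Λ′))) lt
  Generated⇒FaceTrivial lt gone Λ′ = cubeProd-ε (K Λ′) (F Λ′) (λ _ → refl)
  Generated⇒FaceTrivial lt (gmul u v) Λ′ =
    trans (cubeProd-∙ (K Λ′) (F Λ′) _ _)
          (trans (∙-cong (Generated⇒FaceTrivial lt u Λ′) (Generated⇒FaceTrivial lt v Λ′)) (identityˡ ε))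
  Generated⇒FaceTrivial lt (ginv u) Λ′ =
    trans (cubeProd-⁻¹ (K Λ′) (F Λ′) _) (trans (⁻¹-cong (Generated⇒FaceTrivial lt u Λ′)) ε⁻¹≈ε)
  Generated⇒FaceTrivial lt (gext u u≈v) Λ′ =
    trans (cubeProd-cong (K Λ′) (F Λ′) (sym ∘ u≈v)) (Generated⇒FaceTrivial lt u Λ′)

  glue : ∀ {d} → (Subset d → Carrier) → (Subset d → Carrier) → Subset (suc d) → Carrier
  glue h₀ h₁ (outside ∷ S) = h₀ S
  glue h₀ h₁ (inside  ∷ S) = h₁ S

  g-cylinder : ∀ {d n} (Λ : Face d n) a S → g (suc d) (cylinder Λ) a S ≈ glue (g d Λ a) (λ T → g d Λ a T ⁻¹) S
  g-cylinder Λ a (outside ∷ S) = reflexive (≡.trans (g≡generator (cylinder Λ) a (outside ∷ S)) (≡.sym (g≡generator Λ a S)))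
  g-cylinder Λ a (inside  ∷ S) = begin
    g _ (cylinder Λ) a (inside ∷ S)                      ≡⟨ g≡generator (cylinder Λ) a (inside ∷ S) ⟩
    generator (outside ∷ K Λ) (inside ∷ F Λ) a (inside ∷ S) ≈⟨ generator-slice outside inside inside (K Λ) (F Λ) a S ≡.refl ⟩
    generator (K Λ) (F Λ) (a ⁻¹) S                       ≈⟨ generator-⁻¹ (K Λ) (F Λ) a S ⟩
    generator (K Λ) (F Λ) a S ⁻¹                         ≡⟨ cong _⁻¹ (g≡generator Λ a S) ⟨
    g _ Λ a S ⁻¹                                         ∎

  g-layer-outside : ∀ {d n} (Λ : Face d n) a S → g (suc d) (layer outside Λ) a S ≈ glue (g d Λ a) (λ _ → ε) S
  g-layer-outside Λ a (outside ∷ S) = reflexive (≡.trans (g≡generator (layer outside Λ) a (outside ∷ S)) (≡.sym (g≡generator Λ a S)))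
  g-layer-outside Λ a (inside  ∷ S) = reflexive (g≡generator (layer outside Λ) a (inside ∷ S))

  g-layer-inside : ∀ {d n} (Λ : Face d n) a S → g (suc d) (layer inside Λ) (a ⁻¹) S ≈ glue (λ _ → ε) (g d Λ a) S
  g-layer-inside Λ a (outside ∷ S) = reflexive (g≡generator (layer inside Λ) (a ⁻¹) (outside ∷ S))
  g-layer-inside Λ a (inside  ∷ S) = begin
    g _ (layer inside Λ) (a ⁻¹) (inside ∷ S)              ≡⟨ g≡generator (layer inside Λ) (a ⁻¹) (inside ∷ S) ⟩
    generator (inside ∷ K Λ) (outside ∷ F Λ) (a ⁻¹) (inside ∷ S) ≈⟨ generator-slice inside outside inside (K Λ) (F Λ) (a ⁻¹) S ≡.refl ⟩
    generator (K Λ) (F Λ) (a ⁻¹ ⁻¹) S                     ≈⟨ generator-cong (K Λ) (F Λ) (⁻¹-involutive a) S ⟩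
    generator (K Λ) (F Λ) a S                             ≡⟨ g≡generator Λ a S ⟨
    g _ Λ a S                                             ∎

  Generated-cylinder : ∀ {d k v} → Generated d k v → Generated (suc d) (suc k) (glue v (λ S → v S ⁻¹))
  Generated-cylinder (gen Λ a)     = gext (gen (cylinder Λ) a) (g-cylinder Λ a)
  Generated-cylinder gone          = gext gone λ { (outside ∷ S) → refl ; (inside ∷ S) → sym ε⁻¹≈ε }
  Generated-cylinder (gmul u v)    = gext (gmul (Generated-cylinder u) (Generated-cylinder v))
    λ { (outside ∷ S) → refl ; (inside ∷ S) → ⁻¹-∙-comm _ _ }
  Generated-cylinder (ginv u)      = gext (ginv (Generated-cylinder u)) λ { (outside ∷ S) → refl ; (inside ∷ S) → refl }
  Generated-cylinder (gext u u≈v)  = gext (Generated-cylinder u) λ { (outside ∷ S) → u≈v S ; (inside ∷ S) → ⁻¹-cong (u≈v S) }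

  Generated-glueˡ : ∀ {d k v} → Generated d k v → Generated (suc d) k (glue v (λ _ → ε))
  Generated-glueˡ (gen Λ a)    = gext (gen (layer outside Λ) a) (g-layer-outside Λ a)
  Generated-glueˡ gone         = gext gone λ { (outside ∷ S) → refl ; (inside ∷ S) → refl }
  Generated-glueˡ (gmul u v)   = gext (gmul (Generated-glueˡ u) (Generated-glueˡ v))
    λ { (outside ∷ S) → refl ; (inside ∷ S) → identityˡ ε }
  Generated-glueˡ (ginv u)     = gext (ginv (Generated-glueˡ u)) λ { (outside ∷ S) → refl ; (inside ∷ S) → ε⁻¹≈ε }
  Generated-glueˡ (gext u u≈v) = gext (Generated-glueˡ u) λ { (outside ∷ S) → u≈v S ; (inside ∷ S) → refl }

  Generated-glueʳ : ∀ {d k v} → Generated d k v → Generated (suc d) k (glue (λ _ → ε) v)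
  Generated-glueʳ (gen Λ a)    = gext (gen (layer inside Λ) (a ⁻¹)) (g-layer-inside Λ a)
  Generated-glueʳ gone         = gext gone λ { (outside ∷ S) → refl ; (inside ∷ S) → refl }
  Generated-glueʳ (gmul u v)   = gext (gmul (Generated-glueʳ u) (Generated-glueʳ v))
    λ { (outside ∷ S) → identityˡ ε ; (inside ∷ S) → refl }
  Generated-glueʳ (ginv u)     = gext (ginv (Generated-glueʳ u)) λ { (outside ∷ S) → ε⁻¹≈ε ; (inside ∷ S) → refl }
  Generated-glueʳ (gext u u≈v) = gext (Generated-glueʳ u) λ { (outside ∷ S) → refl ; (inside ∷ S) → u≈v S }

  Generated-vertices : ∀ d h → Generated d 0 h
  Generated-vertices zero    h = gext (gen (vertex []) (h [])) λ { [] → refl }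
  Generated-vertices (suc d) h =
    gext (gmul (Generated-glueˡ (Generated-vertices d (h ∘ (outside ∷_)))) (Generated-glueʳ (Generated-vertices d (h ∘ (inside ∷_)))))
      λ { (outside ∷ S) → identityʳ _ ; (inside ∷ S) → identityˡ _ }

  cubeProd-vertex : ∀ {d} (S : Subset d) h → cubeProd S ⊥ h ≡ h S
  cubeProd-vertex []      h = ≡.refl
  cubeProd-vertex (b ∷ S) h = cubeProd-vertex S (h ∘ (b ∷_))

  FaceTrivial₀⇒Generated : ∀ {d k h} → FaceTrivial d 0 h → Generated d k h
  FaceTrivial₀⇒Generated {h = h} trivial = gext gone λ S → sym (trans (reflexive (≡.sym (cubeProd-vertex S h))) (trivial (vertex S)))

  FaceTrivial⇒Generated : ∀ d k m → k + m ≡ suc d → ∀ h → FaceTrivial d m h → Generated d k h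
  FaceTrivial⇒Generated d       zero    m       _  h _       = Generated-vertices d h
  FaceTrivial⇒Generated d       (suc k) zero    _  h trivial = FaceTrivial₀⇒Generated trivial
  FaceTrivial⇒Generated zero    (suc k) (suc m) eq h _       = case ≡.trans (≡.sym (+-suc k m)) (suc-injective eq) of λ ()
  FaceTrivial⇒Generated (suc d) (suc k) (suc m) eq h trivial = gext (gmul (Generated-glueʳ u-generated) cylinder-generated) reassemble
    where
    h₀ : Subset d → Carrier
    h₀ = h ∘ (outside ∷_)
    h₀± : Subset (suc d) → Carrier
    h₀± = glue h₀ (λ S → h₀ S ⁻¹)
    cylinder-generated : Generated (suc d) (suc k) h₀±
    cylinder-generated = Generated-cylinder (FaceTrivial⇒Generated d k (suc m) (suc-injective eq) h₀ (trivial ∘ layer outside))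
    w : Subset (suc d) → Carrier
    w S = h S ∙ h₀± S ⁻¹
    w-trivial : FaceTrivial (suc d) (suc m) w
    w-trivial Λ = begin
      cubeProd (K Λ) (F Λ) w                                            ≈⟨ cubeProd-∙ (K Λ) (F Λ) h _ ⟩
      cubeProd (K Λ) (F Λ) h ∙ cubeProd (K Λ) (F Λ) (λ S → h₀± S ⁻¹)      ≈⟨ ∙-congˡ (cubeProd-⁻¹ (K Λ) (F Λ) h₀±) ⟩
      cubeProd (K Λ) (F Λ) h ∙ cubeProd (K Λ) (F Λ) h₀± ⁻¹                ≈⟨ ∙-cong (trivial Λ) (⁻¹-cong h₀±-trivial) ⟩
      ε ∙ ε ⁻¹                                                          ≈⟨ inverseʳ ε ⟩
      ε                                                                 ∎
      where
      h₀±-trivial : cubeProd (K Λ) (F Λ) h₀± ≈ ε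
      h₀±-trivial = Generated⇒FaceTrivial (≤-reflexive (≡.sym eq)) cylinder-generated Λ
    u : Subset d → Carrier
    u = w ∘ (inside ∷_)
    u-trivial : FaceTrivial d m u
    u-trivial Λ = begin
      cubeProd (K Λ) (F Λ) u                                      ≈⟨ identityˡ _ ⟨
      ε ∙ cubeProd (K Λ) (F Λ) u                                  ≈⟨ ∙-congʳ (cubeProd-ε (K Λ) (F Λ) (λ S → inverseʳ (h₀ S))) ⟨
      cubeProd (K Λ) (F Λ) (w ∘ (outside ∷_)) ∙ cubeProd (K Λ) (F Λ) u ≈⟨ w-trivial (cylinder Λ) ⟩
      ε                                                           ∎
    u-generated : Generated d (suc k) u
    u-generated = FaceTrivial⇒Generated d (suc k) m (≡.trans (≡.sym (+-suc k m)) (suc-injective eq)) u u-trivial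
    reassemble : ∀ S → glue (λ _ → ε) u S ∙ h₀± S ≈ h S
    reassemble (outside ∷ S) = identityˡ _
    reassemble (inside  ∷ S) = trans (assoc _ _ _) (trans (∙-congˡ (inverseˡ _)) (identityʳ _))

mainTheorem8 : ∀ {c ℓ : Level} (A : AbelianGroup c ℓ) (d k : ℕ) → 1 ≤ k → k ≤ d →
    let open Cube A d in
    (∀ (Λ : Face d k) (a : AbelianGroup.Carrier A) → InBdk k (g Λ a))
    × (∀ (h : B) → InBdk k h → Generated k h)
mainTheorem8 A d k _ k≤d =
  (λ Λ a Λ′ → trans (faceProd≈cubeProd A _ Λ′) (Generated⇒FaceTrivial A (≤-reflexive (≡.sym dims)) (gen Λ a) Λ′)) ,
  (λ h h∈B → FaceTrivial⇒Generated A d k (suc (d ∸ k)) dims h (λ Λ → trans (sym (faceProd≈cubeProd A h Λ)) (h∈B Λ)))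
  where
  open AbelianGroup A using (trans; sym)
  open Cube A d using (gen)
  dims : k + suc (d ∸ k) ≡ suc d
  dims = ≡.trans (+-suc k (d ∸ k)) (cong suc (m+[n∸m]≡n k≤d))
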